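{- Let $b\ge 2$ and $A=\{1,b\}$. Let $Q(\ell)=\phi^\ell+z^\ell+\bar z^\ell$, where $\phi,z,\bar z$ are the three complex roots of $x^3-x-1$. Define recursively for positive integers $\ell$ and $L$ $$N'(\ell)=\frac{Q(\ell)-\sum_{d\mid \ell,\ d<\ell} d\,N'(d)}{\ell},\qquad N(L)=\sum_{\ell\mid L}N'(\ell).$$ Then for every positive divisor $\ell$ of $1+b$, the number of distinct periodicities of $A$ of length $\ell$ is $N'(\ell)$, and the total number of distinct periodicities of $A$ is $N(b+1)$.
   Context: For a finite nonempty set $A$ of positive integers let $\alpha=\max A$. For a seed $S=s_1\cdots s_\alpha\in\{0,1\}^\alpha$, define $w^{A,S}(-\alpha-1+j)=s_j$ for $j=1,\ldots,\alpha$ and $w^{A,S}(n)=1-\min\{w^{A,S}(n-x):x\in A\}$ for $n\ge0$. $\mathcal W^A=\{(w^{A,S}(n))_{n\ge0}: S\in\{0,1\}^\alpha\}$; for $|A|\le2$ all these sequences are purely periodic. Two such sequences $u,v$ are similar if one is a shift of the other, i.e. there is $t\ge0$ with $u(n+t)=v(n)$ for all $n\ge0$ or $v(n+t)=u(n)$ for all $n\ge0$. A distinct periodicity of $A$ is an equivalence class of $\mathcal W^A$ under similarity; its length is the least period of its members. -}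

module Defs where

open import Data.Nat as ℕ using (ℕ; zero; suc; _∸_; _<_; _≤_; _<?_)
open import Data.Nat.Divisibility using (_∣_; _∣?_)
open import Data.Integer using (+_)
open import Data.Rational as ℚ using (ℚ; _/_; 0ℚ)
open import Data.Bool using (Bool; true; false; not; _∧_)
open import Data.Vec using (Vec; lookup)
open import Data.Fin using (fromℕ<)
open import Data.List using (List; length)
open import Data.List.Relation.Unary.All using (All)
open import Data.List.Relation.Unary.Any using (Any)
open import Data.List.Relation.Unary.AllPairs using (AllPairs)
open import Data.Product using (Σ; ∃; _×_)
open import Data.Sum using (_⊎_)
open import Relation.Nullary using (¬_; yes; no)
open import Relation.Binary.PropositionalEquality using (_≡_)

-- Q(ℓ) = φ^ℓ + z^ℓ + z̄^ℓ, the power sums of the roots of x³ - x - 1.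
-- By Newton's identities (x³ = x + 1) these satisfy
-- Q(0)=3, Q(1)=0, Q(2)=2, Q(n+3) = Q(n+1) + Q(n)  (Perrin numbers).

Q : ℕ → ℕ
Q zero = 3
Q (suc zero) = 0
Q (suc (suc zero)) = 2
Q (suc (suc (suc n))) = Q (suc n) ℕ.+ Q n

toℚ : ℕ → ℚ
toℚ n = (+ n) / 1

sumDivUpTo : (ℕ → ℚ) → (ℓ k : ℕ) → ℚ
sumDivUpTo f ℓ zero = 0ℚ
sumDivUpTo f ℓ (suc k) with suc k ∣? ℓ
... | yes _ = sumDivUpTo f ℓ k ℚ.+ f (suc k)
... | no  _ = sumDivUpTo f ℓ k

-- N'(ℓ) = (Q(ℓ) - Σ_{d ∣ ℓ, d < ℓ} d N'(d)) / ℓ, computed with fuel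
-- (fuel ≥ ℓ suffices; all recursive arguments d < ℓ).
N'aux : ℕ → ℕ → ℚ
N'aux zero ℓ = 0ℚ
N'aux (suc f) zero = 0ℚ
N'aux (suc f) (suc k) =
  (toℚ (Q (suc k)) ℚ.- sumDivUpTo (λ d → toℚ d ℚ.* N'aux f d) (suc k) k)
    ℚ.* ((+ 1) / suc k)

N' : ℕ → ℚ
N' ℓ = N'aux ℓ ℓ

N : ℕ → ℚ
N L = sumDivUpTo N' L L

-- The sequences w^{A,S} for A = {1, b} (so α = b), values 0/1 encoded as
-- false/true.  ext S m = w^{A,S}(m - b) for m ≥ 0, i.e. positions -b,...
-- For m < b:  ext S m = s_{m+1}  (w(-b-1+j) = s_j with j = m+1).
-- For m ≥ b:  w(n) = 1 - min(w(n-1), w(n-b)) = NAND.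

extAux : (b : ℕ) → Vec Bool b → ℕ → ℕ → Bool
extAux b S zero m = false  -- unreachable with sufficient fuel
extAux b S (suc f) m with m <? b
... | yes m<b = lookup S (fromℕ< m<b)
... | no  _   = not (extAux b S f (m ∸ 1) ∧ extAux b S f (m ∸ b))

ext : (b : ℕ) → Vec Bool b → ℕ → Bool
ext b S m = extAux b S (suc m) m

w : (b : ℕ) → Vec Bool b → ℕ → Bool
w b S n = ext b S (n ℕ.+ b)

Similar : (ℕ → Bool) → (ℕ → Bool) → Set
Similar u v = (∃ λ t → ∀ n → u (n ℕ.+ t) ≡ v n)
            ⊎ (∃ λ t → ∀ n → v (n ℕ.+ t) ≡ u n)

IsPeriod : (ℕ → Bool) → ℕ → Set
IsPeriod u p = 1 ≤ p × (∀ n → u (n ℕ.+ p) ≡ u n)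

LeastPeriod : (ℕ → Bool) → ℕ → Set
LeastPeriod u p = IsPeriod u p × (∀ q → IsPeriod u q → p ≤ q)

-- The number of similarity classes of 𝒲^{{1,b}} all of whose members
-- satisfy P (P is assumed to be a class invariant) equals k:
-- there is a list of k seeds whose sequences satisfy P, are pairwise
-- non-similar, and every member of 𝒲^{{1,b}} satisfying P is similar to one.
NumClasses : (b : ℕ) → ((ℕ → Bool) → Set) → ℕ → Set
NumClasses b P k =
  Σ (List (Vec Bool b)) λ reps →
    length reps ≡ k
    × All (λ S → P (w b S)) reps
    × AllPairs (λ S T → ¬ Similar (w b S) (w b T)) reps
    × (∀ S → P (w b S) → Any (λ T → Similar (w b S) (w b T)) reps)

NumPeriodicitiesOfLength : (b ℓ : ℕ) → ℕ → Set
NumPeriodicitiesOfLength b ℓ k = NumClasses b (λ u → LeastPeriod u ℓ) k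

NumPeriodicities : (b : ℕ) → ℕ → Set
NumPeriodicities b k = NumClasses b (λ _ → Data.Unit.⊤) k
  where import Data.Unit

{-# OPTIONS --safe #-}
module Submission where

-- For A = {1, b} the sequences obey w(n) = nand(w(n − 1), w(n − b)).  A zero forces ones at the
-- two positions that determine the letter b + 1 further on, so zeros recur with period b + 1,
-- and then so do ones: every sequence is (b + 1)-periodic from n = b + 1 on.  For a
-- (b + 1)-periodic sequence w(n − b) = w(n + 1), so the recurrence becomes the symmetric rule
-- w(n) = nand(w(n − 1), w(n + 1)), and every (b + 1)-periodic sequence obeying it is generated by
-- its first b letters.  Hence the periodicities of length ℓ ∣ b + 1 are the rotation classes of
-- primitive cyclic words of length ℓ obeying the rule.  Obeying the rule is checked by a transfer
-- matrix on pairs of consecutive letters whose traces are the Perrin numbers Q(ℓ); sorting the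
-- Q(ℓ) good words of length ℓ by least period d gives Σ_{d ∣ ℓ} d · c(d) = Q(ℓ) for the number
-- c(d) of classes of length d.  This is the recursion defining N′, so c = N′, and summing over the
-- divisors of b + 1 gives N(b + 1).

open import Data.Nat
  using (ℕ; zero; suc; _+_; _*_; _∸_; _%_; _/_; _≤_; _<_; _≤?_; _<?_; z≤n; s≤s; s≤s⁻¹; z<s; NonZero; >-nonZero)
open import Data.Nat.Properties
  using ( _≟_; +-identityʳ; +-comm; +-assoc; +-suc; +-commutativeSemigroup; +-monoˡ-≤; m≤m*n; m≤m+n; m≤n+m
        ; m∸n+n≡m; m+n∸n≡m; m∸n≤m; ∸-monoʳ-<; m<n⇒0<n∸m; ≤-refl; ≤-trans; ≤-antisym; ≤-pred; ≤-<-trans; <-trans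
        ; <⇒≤; <⇒≢; <⇒≱; ≮⇒≥; ≰⇒>; ≤∧≢⇒<; m≤n⇒m≤1+n; <-cmp; anyUpTo?; allUpTo?; module ≤-Reasoning)
open import Data.Nat.DivMod using (_mod_; m≡m%n+[m/n]*n; m%n<n; [m+n]%n≡m%n; m<n⇒m%n≡m)
open import Data.Nat.Divisibility using (_∣_; _∣?_; divides; ∣-refl; ∣⇒≤; m%n≡0⇒n∣m)
open import Data.Nat.Induction using (<-rec)
open import Data.Nat.Coprimality using (1-coprimeTo) renaming (sym to coprime-sym)
import Data.Integer as ℤ
import Data.Integer.Properties as ℤ
open import Data.Rational using (ℚ; mkℚ; 1ℚ)
import Data.Rational as ℚ
import Data.Rational.Properties as ℚ
open import Algebra.Properties.CommutativeSemigroup +-commutativeSemigroup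
  using (xy∙z≈xz∙y; x∙yz≈xz∙y; x∙yz≈y∙xz; interchange)
open import Algebra.Properties.AbelianGroup ℚ.+-0-abelianGroup using (xyx⁻¹≈y)
open import Data.Bool using (Bool; true; false; not; _∧_; T)
open import Data.Bool.Properties using (T-∧; ∧-zeroʳ)
import Data.Bool.Properties as Bool
open import Data.Fin using (Fin; toℕ; fromℕ<)
open import Data.Fin.Properties using (toℕ-fromℕ<; toℕ-injective; toℕ<n)
open import Data.Vec using (Vec; []; _∷_; lookup; tabulate)
import Data.Vec.Properties as Vec
open import Data.List
  using (List; []; _∷_; [_]; length; map; _++_; concatMap; applyUpTo; filter; filterᵇ; deduplicate)
open import Data.List.Properties using (length-++; length-map; length-applyUpTo; filter-++; filter-none)
open import Data.List.Membership.Propositional using (_∈_; find; lose)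
open import Data.List.Membership.Propositional.Properties
  using ( ∈-map⁺; ∈-map⁻; ∈-++⁺ˡ; ∈-++⁺ʳ; ∈-++⁻; ∈-∃++; ∈-concatMap⁺; ∈-concatMap⁻; ∈-applyUpTo⁺; ∈-applyUpTo⁻
        ; ∈-filter⁺; ∈-filter⁻; ∈-deduplicate⁻)
open import Data.List.Relation.Binary.Subset.Propositional using (_⊆_)
open import Data.List.Relation.Binary.Disjoint.Propositional using (Disjoint)
open import Data.List.Relation.Unary.Any as Any using (Any; here; there)
import Data.List.Relation.Unary.Any.Properties as Any
import Data.List.Relation.Unary.All as All
import Data.List.Relation.Unary.All.Properties as All
open import Data.List.Relation.Unary.AllPairs as AllPairs using (AllPairs)
import Data.List.Relation.Unary.AllPairs.Properties as AllPairs
open import Data.List.Relation.Unary.Unique.Propositional using (Unique)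
import Data.List.Relation.Unary.Unique.Propositional.Properties as Unique
open import Data.Product using (Σ; ∃; _×_; _,_; proj₁; proj₂)
open import Data.Sum using (inj₁; inj₂)
open import Data.Unit using (tt)
open import Function using (_∘_; Equivalence)
open import Relation.Binary.Core using (Rel)
open import Relation.Binary.Definitions using (Decidable; tri<; tri≈; tri>)
open import Relation.Binary.PropositionalEquality
  using (_≡_; _≢_; refl; sym; trans; cong; cong₂; subst; _≗_; module ≡-Reasoning)
open import Relation.Nullary using (Dec; yes; no; ¬_; ¬?; contradiction; _×-dec_)
open import Relation.Nullary.Decidable using (map′; ⌊_⌋; toWitness; fromWitness)

open import Defs

private variable
  A B : Set
  x : A
  xs ys : List A
  c d d′ i i′ j k ℓ n n₀ p q : ℕ
  u v v′ : ℕ → A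
  E F : ℕ → Bool

filterᵇ-map : ∀ (P : B → Bool) (f : A → B) xs → filterᵇ P (map f xs) ≡ map f (filterᵇ (P ∘ f) xs)
filterᵇ-map P f []       = refl
filterᵇ-map P f (x ∷ xs) with P (f x)
... | true  = cong (f x ∷_) (filterᵇ-map P f xs)
... | false = filterᵇ-map P f xs

length-concatMap-const : ∀ (f : A → List B) xs → (∀ x → length (f x) ≡ k) → length (concatMap f xs) ≡ length xs * k
length-concatMap-const f []       _ = refl
length-concatMap-const f (x ∷ xs) h = trans (length-++ (f x)) (cong₂ _+_ (h x) (length-concatMap-const f xs h))

unique-⊆⇒length-≤ : Unique xs → xs ⊆ ys → length xs ≤ length ys
unique-⊆⇒length-≤ {xs = []}                    _                    _     = z≤n
unique-⊆⇒length-≤ {xs = x ∷ xs} {ys = ys} (x∉xs AllPairs.∷ !xs) xs⊆ys with ∈-∃++ (xs⊆ys (here refl))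
... | ys₁ , ys₂ , refl = begin
  suc (length xs)               ≤⟨ s≤s (unique-⊆⇒length-≤ !xs xs⊆ys₁ys₂) ⟩
  suc (length (ys₁ ++ ys₂))     ≡⟨ cong suc (length-++ ys₁) ⟩
  suc (length ys₁ + length ys₂) ≡⟨ +-suc (length ys₁) (length ys₂) ⟨
  length ys₁ + length (x ∷ ys₂) ≡⟨ length-++ ys₁ ⟨
  length (ys₁ ++ x ∷ ys₂)       ∎
  where
  open ≤-Reasoning
  xs⊆ys₁ys₂ : xs ⊆ ys₁ ++ ys₂
  xs⊆ys₁ys₂ z∈xs with ∈-++⁻ ys₁ (xs⊆ys (there z∈xs))
  ... | inj₁ z∈ys₁         = ∈-++⁺ˡ z∈ys₁
  ... | inj₂ (here refl)   = contradiction refl (All.lookup x∉xs z∈xs)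
  ... | inj₂ (there z∈ys₂) = ∈-++⁺ʳ ys₁ z∈ys₂

unique-⊆⊇⇒length-≡ : Unique xs → Unique ys → xs ⊆ ys → ys ⊆ xs → length xs ≡ length ys
unique-⊆⊇⇒length-≡ !xs !ys xs⊆ys ys⊆xs = ≤-antisym (unique-⊆⇒length-≤ !xs xs⊆ys) (unique-⊆⇒length-≤ !ys ys⊆xs)

deduplicate-allPairs : ∀ {ρ} {R : Rel A ρ} (R? : Decidable R) xs → AllPairs (λ x y → ¬ R x y) (deduplicate R? xs)
deduplicate-allPairs R? []       = AllPairs.[]
deduplicate-allPairs R? (x ∷ xs) =
  All.all-filter (¬? ∘ R? x) (deduplicate R? xs) AllPairs.∷ AllPairs.filter⁺ _ (deduplicate-allPairs R? xs)

allPairs-map-∈ : ∀ {ρ σ} {R : Rel A ρ} {S : Rel A σ} → (∀ {x y} → x ∈ xs → y ∈ xs → R x y → S x y) →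
                 AllPairs R xs → AllPairs S xs
allPairs-map-∈ f AllPairs.[]         = AllPairs.[]
allPairs-map-∈ f (Rx AllPairs.∷ Rxs) =
  All.tabulate (λ y∈ → f (here refl) (there y∈) (All.lookup Rx y∈)) AllPairs.∷
  allPairs-map-∈ (λ x∈ y∈ → f (there x∈) (there y∈)) Rxs

-- Follows the recursion of sumDivUpTo, so that its length is a divisor sum.
concatDivUpTo : (ℕ → List A) → ℕ → ℕ → List A
concatDivUpTo f ℓ zero    = []
concatDivUpTo f ℓ (suc k) with suc k ∣? ℓ
... | yes _ = concatDivUpTo f ℓ k ++ f (suc k)
... | no  _ = concatDivUpTo f ℓ k

module _ (f : ℕ → List A) (ℓ : ℕ) where

  ∈-concatDivUpTo⁺ : 1 ≤ d → d ≤ k → d ∣ ℓ → x ∈ f d → x ∈ concatDivUpTo f ℓ k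
  ∈-concatDivUpTo⁺ {k = zero}  1≤d d≤0 _ _ = contradiction (≤-trans 1≤d d≤0) λ ()
  ∈-concatDivUpTo⁺ {d = d} {k = suc k} 1≤d d≤k d∣ℓ x∈ with suc k ∣? ℓ | d ≟ suc k
  ... | yes _    | yes refl = ∈-++⁺ʳ (concatDivUpTo f ℓ k) x∈
  ... | no  ¬d∣ℓ | yes refl = contradiction d∣ℓ ¬d∣ℓ
  ... | yes _    | no d≢    = ∈-++⁺ˡ (∈-concatDivUpTo⁺ 1≤d (≤-pred (≤∧≢⇒< d≤k d≢)) d∣ℓ x∈)
  ... | no  _    | no d≢    = ∈-concatDivUpTo⁺ 1≤d (≤-pred (≤∧≢⇒< d≤k d≢)) d∣ℓ x∈

  InDivisorBlock : ℕ → A → Set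
  InDivisorBlock k x = ∃ λ d → 1 ≤ d × d ≤ k × d ∣ ℓ × x ∈ f d

  private
    widen : InDivisorBlock k x → InDivisorBlock (suc k) x
    widen (d , 1≤d , d≤k , rest) = d , 1≤d , m≤n⇒m≤1+n d≤k , rest

  ∈-concatDivUpTo⁻ : ∀ k → x ∈ concatDivUpTo f ℓ k → InDivisorBlock k x
  ∈-concatDivUpTo⁻ (suc k) x∈ with suc k ∣? ℓ
  ... | no  _   = widen (∈-concatDivUpTo⁻ k x∈)
  ... | yes d∣ℓ with ∈-++⁻ (concatDivUpTo f ℓ k) x∈
  ...   | inj₁ x∈′ = widen (∈-concatDivUpTo⁻ k x∈′)
  ...   | inj₂ x∈′ = suc k , s≤s z≤n , ≤-refl , d∣ℓ , x∈′

  allPairs-concatDivUpTo : ∀ {ρ} {R : Rel A ρ} → (∀ {d} → 1 ≤ d → d ∣ ℓ → AllPairs R (f d)) →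
    (∀ {d d′ x y} → d < d′ → 1 ≤ d → d ∣ ℓ → d′ ∣ ℓ → x ∈ f d → y ∈ f d′ → R x y) →
    ∀ k → AllPairs R (concatDivUpTo f ℓ k)
  allPairs-concatDivUpTo within across zero    = AllPairs.[]
  allPairs-concatDivUpTo within across (suc k) with suc k ∣? ℓ
  ... | no  _   = allPairs-concatDivUpTo within across k
  ... | yes k+1∣ℓ = AllPairs.++⁺ (allPairs-concatDivUpTo within across k) (within (s≤s z≤n) k+1∣ℓ)
    (All.tabulate λ x∈ → let d , 1≤d , d≤k , d∣ℓ , x∈f = ∈-concatDivUpTo⁻ k x∈
                         in All.tabulate (across (s≤s d≤k) 1≤d d∣ℓ k+1∣ℓ x∈f))

-- Periodic sequences and shifts

shift : ℕ → (ℕ → A) → ℕ → A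
shift i u n = u (n + i)

Periodic : (ℕ → A) → ℕ → Set
Periodic u p = ∀ n → u (n + p) ≡ u n

periodic-+* : Periodic u p → ∀ n q → u (n + q * p) ≡ u n
periodic-+* {u = u}         P n zero    = cong u (+-identityʳ n)
periodic-+* {u = u} {p = p} P n (suc q) = begin
  u (n + (p + q * p)) ≡⟨ cong (λ m → u (n + m)) (+-comm p (q * p)) ⟩
  u (n + (q * p + p)) ≡⟨ cong u (+-assoc n (q * p) p) ⟨
  u (n + q * p + p)   ≡⟨ P (n + q * p) ⟩
  u (n + q * p)       ≡⟨ periodic-+* P n q ⟩
  u n                 ∎
  where open ≡-Reasoning

periodic-+% : .{{_ : NonZero p}} → Periodic u p → ∀ n t → u (n + t % p) ≡ u (n + t)
periodic-+% {p = p} {u = u} P n t = begin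
  u (n + t % p)               ≡⟨ periodic-+* P (n + t % p) (t / p) ⟨
  u (n + t % p + t / p * p)   ≡⟨ cong u (+-assoc n (t % p) _) ⟩
  u (n + (t % p + t / p * p)) ≡⟨ cong (λ m → u (n + m)) (m≡m%n+[m/n]*n t p) ⟨
  u (n + t)                   ∎
  where open ≡-Reasoning

periodic-% : .{{_ : NonZero p}} → Periodic u p → ∀ t → u (t % p) ≡ u t
periodic-% P = periodic-+% P 0

periodic-∣ : Periodic u d → d ∣ ℓ → Periodic u ℓ
periodic-∣ P (divides q refl) n = periodic-+* P n q

periodic-≗ : u ≗ v → Periodic u p → Periodic v p
periodic-≗ {p = p} u≗v P n = trans (sym (u≗v (n + p))) (trans (P n) (u≗v n))

periodic-shift : ∀ i → Periodic u p → Periodic (shift i u) p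
periodic-shift {u = u} {p = p} i P n = trans (cong u (xy∙z≈xz∙y n p i)) (P (n + i))

periodic-from : ∀ n₀ → (∀ n → n₀ ≤ n → u (n + p) ≡ u n) → Periodic (shift n₀ u) p
periodic-from {u = u} {p = p} n₀ tail n = trans (cong u (xy∙z≈xz∙y n p n₀)) (tail (n + n₀) (m≤n+m n₀ n))

≤-+* : ∀ n m → 1 ≤ ℓ → m ≤ n + m * ℓ
≤-+* {ℓ = ℓ} n m 1≤ℓ = ≤-trans (m≤m*n m ℓ {{>-nonZero 1≤ℓ}}) (m≤n+m (m * ℓ) n)

periodic-eventually : 1 ≤ ℓ → Periodic u ℓ → (∀ n → n₀ ≤ n → u (n + p) ≡ u n) → Periodic u p
periodic-eventually {ℓ = ℓ} {u = u} {n₀ = n₀} {p = p} 1≤ℓ P tail n = begin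
  u (n + p)           ≡⟨ periodic-+* P (n + p) n₀ ⟨
  u (n + p + n₀ * ℓ)  ≡⟨ cong u (xy∙z≈xz∙y n p (n₀ * ℓ)) ⟩
  u (n + n₀ * ℓ + p)  ≡⟨ tail (n + n₀ * ℓ) (≤-+* n n₀ 1≤ℓ) ⟩
  u (n + n₀ * ℓ)      ≡⟨ periodic-+* P n n₀ ⟩
  u n                 ∎
  where open ≡-Reasoning

periodic-unshift : 1 ≤ ℓ → Periodic u ℓ → Periodic (shift i u) q → Periodic u q
periodic-unshift {u = u} {i = i} {q = q} 1≤ℓ P Pᵢ = periodic-eventually 1≤ℓ P tail
  where
  tail : ∀ n → i ≤ n → u (n + q) ≡ u n
  tail n i≤n = begin
    u (n + q)           ≡⟨ cong (λ m → u (m + q)) (m∸n+n≡m i≤n) ⟨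
    u (n ∸ i + i + q)   ≡⟨ cong u (xy∙z≈xz∙y (n ∸ i) i q) ⟩
    u (n ∸ i + q + i)   ≡⟨ Pᵢ (n ∸ i) ⟩
    u (n ∸ i + i)       ≡⟨ cong u (m∸n+n≡m i≤n) ⟩
    u n                 ∎
    where open ≡-Reasoning

shift-≗⇒periodic : i ≤ j → shift i u ≗ shift j u → Periodic (shift i u) (j ∸ i)
shift-≗⇒periodic {i = i} {j = j} {u = u} i≤j eq n = begin
  u (n + (j ∸ i) + i) ≡⟨ cong u (+-assoc n (j ∸ i) i) ⟩
  u (n + (j ∸ i + i)) ≡⟨ cong (λ m → u (n + m)) (m∸n+n≡m i≤j) ⟩
  u (n + j)           ≡⟨ eq n ⟨
  u (n + i)           ∎
  where open ≡-Reasoning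

shift-% : .{{_ : NonZero p}} → Periodic u p → ∀ t → shift (t % p) u ≗ shift t u
shift-% P t n = periodic-+% P n t

record _⇝_ (u v : ℕ → A) : Set where
  constructor _,_
  field
    offset  : ℕ
    shifted : shift offset u ≗ v

⇝-refl : u ⇝ u
⇝-refl {u = u} = 0 , λ n → cong u (+-identityʳ n)

⇝-shift : ∀ i → u ⇝ shift i u
⇝-shift i = i , λ _ → refl

⇝-≗ : v ≗ v′ → u ⇝ v → u ⇝ v′
⇝-≗ v≗v′ (t , h) = t , λ n → trans (h n) (v≗v′ n)

⇝-trans : u ⇝ v → v ⇝ v′ → u ⇝ v′
⇝-trans {u = u} (t , h) (t′ , h′) =
  t + t′ , λ n → trans (cong u (x∙yz≈xz∙y n t t′)) (trans (h (n + t′)) (h′ n))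

⇝-sym : IsPeriod u p → u ⇝ v → v ⇝ u
⇝-sym {u = u} {p = p} {v = v} (1≤p , P) (t , h) = t * p ∸ t , λ n → begin
  v (n + (t * p ∸ t))     ≡⟨ h (n + (t * p ∸ t)) ⟨
  u (n + (t * p ∸ t) + t) ≡⟨ cong u (+-assoc n _ t) ⟩
  u (n + (t * p ∸ t + t)) ≡⟨ cong (λ m → u (n + m)) (m∸n+n≡m (m≤m*n t p {{>-nonZero 1≤p}})) ⟩
  u (n + t * p)           ≡⟨ periodic-+* P n t ⟩
  u n                     ∎
  where open ≡-Reasoning

⇝⇒similar : u ⇝ v → Similar u v
⇝⇒similar (t , h) = inj₁ (t , h)

similar⇒⇝ : IsPeriod v p → Similar u v → u ⇝ v
similar⇒⇝ _  (inj₁ (t , h)) = t , h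
similar⇒⇝ Pv (inj₂ (t , h)) = ⇝-sym Pv (t , h)

leastPeriod-unique : LeastPeriod u d → LeastPeriod u d′ → d ≡ d′
leastPeriod-unique (Pd , min) (Pd′ , min′) = ≤-antisym (min _ Pd′) (min′ _ Pd)

leastPeriod-≗ : u ≗ v → LeastPeriod u d → LeastPeriod v d
leastPeriod-≗ u≗v ((1≤d , P) , min) =
  (1≤d , periodic-≗ u≗v P) , λ q (1≤q , Pq) → min q (1≤q , periodic-≗ (λ n → sym (u≗v n)) Pq)

leastPeriod-shift : ∀ i → LeastPeriod u d → LeastPeriod (shift i u) d
leastPeriod-shift i ((1≤d , P) , min) =
  (1≤d , periodic-shift i P) , λ q (1≤q , Pq) → min q (1≤q , periodic-unshift 1≤d P Pq)

⇝-leastPeriod : u ⇝ v → LeastPeriod u d → LeastPeriod v d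
⇝-leastPeriod (t , h) L = leastPeriod-≗ h (leastPeriod-shift t L)

leastPeriod-∣ : LeastPeriod u d → IsPeriod u p → d ∣ p
leastPeriod-∣ {u = u} {d = d} {p = p} ((1≤d , P) , min) (_ , Pp) = m%n≡0⇒n∣m p d (remainder≡0 (p % d) refl)
  where
  instance _ = >-nonZero 1≤d
  remainder-period : Periodic u (p % d)
  remainder-period n = trans (periodic-+% P n p) (Pp n)
  remainder≡0 : ∀ r → p % d ≡ r → p % d ≡ 0
  remainder≡0 zero    eq = eq
  remainder≡0 (suc r) eq =
    contradiction (min (p % d) (subst (1 ≤_) (sym eq) (s≤s z≤n) , remainder-period)) (<⇒≱ (m%n<n p d))

shifts-differ : LeastPeriod u d → i < j → j < d → ¬ (shift i u ≗ shift j u)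
shifts-differ {u = u} {i = i} {j = j} ((1≤d , P) , min) i<j j<d eq =
  <⇒≱ (≤-<-trans (m∸n≤m j i) j<d)
      (min (j ∸ i) (m<n⇒0<n∸m i<j , periodic-unshift {u = u} {i = i} 1≤d P (shift-≗⇒periodic {u = u} (<⇒≤ i<j) eq)))

leastPeriod-shift-injective : LeastPeriod u d → i < d → j < d → shift i u ≗ shift j u → i ≡ j
leastPeriod-shift-injective {i = i} {j = j} L i<d j<d eq with <-cmp i j
... | tri< i<j _ _ = contradiction eq (shifts-differ L i<j j<d)
... | tri≈ _ i≡j _ = i≡j
... | tri> _ _ j<i = contradiction (λ n → sym (eq n)) (shifts-differ L j<i i<d)

periodic? : IsPeriod u n₀ → ∀ q → Dec (Periodic u q)
periodic? {u = u} {n₀ = n₀} (1≤n₀ , P) q =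
  map′ extend (λ Pq {n} _ → Pq n) (allUpTo? (λ n → u (n + q) Bool.≟ u n) n₀)
  where
  instance _ = >-nonZero 1≤n₀
  extend : (∀ {n} → n < n₀ → u (n + q) ≡ u n) → Periodic u q
  extend below n = begin
    u (n + q)       ≡⟨ cong u (+-comm n q) ⟩
    u (q + n)       ≡⟨ periodic-+% P q n ⟨
    u (q + n % n₀)  ≡⟨ cong u (+-comm q (n % n₀)) ⟩
    u (n % n₀ + q)  ≡⟨ below (m%n<n n n₀) ⟩
    u (n % n₀)      ≡⟨ periodic-% P n ⟩
    u n             ∎
    where open ≡-Reasoning

leastPeriod-exists : IsPeriod u n₀ → ∃ λ d → LeastPeriod u d
leastPeriod-exists {u = u} {n₀ = n₀} IP = <-rec (λ M → IsPeriod u M → ∃ λ d → LeastPeriod u d) search n₀ IP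
  where
  search : ∀ M → (∀ {q} → q < M → IsPeriod u q → ∃ λ d → LeastPeriod u d) → IsPeriod u M → ∃ λ d → LeastPeriod u d
  search M smaller PM with anyUpTo? (λ q → (1 ≤? q) ×-dec periodic? IP q) M
  ... | yes (q , q<M , Pq) = smaller q<M Pq
  ... | no  none           = M , PM , λ q Pq → ≮⇒≥ (λ q<M → none (q , q<M , Pq))

leastPeriod? : IsPeriod u n₀ → ∀ d → Dec (LeastPeriod u d)
leastPeriod? IP d with leastPeriod-exists IP
... | d₀ , L₀ = map′ (λ { refl → L₀ }) (λ L → leastPeriod-unique L L₀) (d ≟ d₀)

-- Cyclic words

prefix : (n : ℕ) → (ℕ → A) → Vec A n
prefix n u = tabulate (u ∘ toℕ)

prefix-≗ : u ≗ v → prefix n u ≡ prefix n v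
prefix-≗ u≗v = Vec.tabulate-cong (u≗v ∘ toℕ)

-- The empty word yields the junk sequence false, false, …
cycle : Vec Bool n → ℕ → Bool
cycle {zero}  []  _ = false
cycle {suc n} xs k = lookup xs (k mod suc n)

cycle-periodic : (xs : Vec Bool n) → Periodic (cycle xs) n
cycle-periodic {zero}  []  k = refl
cycle-periodic {suc n} xs k =
  cong (lookup xs) (toℕ-injective (trans (toℕ-fromℕ< _) (trans ([m+n]%n≡m%n k (suc n)) (sym (toℕ-fromℕ< _)))))

cycle-prefix : 1 ≤ n → Periodic u n → cycle (prefix n u) ≗ u
cycle-prefix {n = suc n} {u = u} _ P k =
  trans (Vec.lookup∘tabulate (u ∘ toℕ) (k mod suc n)) (trans (cong u (toℕ-fromℕ< _)) (periodic-% P k))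

prefix-cycle : (xs : Vec Bool n) → prefix n (cycle xs) ≡ xs
prefix-cycle {zero}  []  = refl
prefix-cycle {suc n} xs = trans (Vec.tabulate-cong (cong (lookup xs) ∘ toℕ-mod)) (Vec.tabulate∘lookup xs)
  where
  toℕ-mod : (i : Fin (suc n)) → toℕ i mod suc n ≡ i
  toℕ-mod i = toℕ-injective (trans (toℕ-fromℕ< _) (m<n⇒m%n≡m (toℕ<n i)))

allWords : (n : ℕ) → List (Vec Bool n)
allWords zero    = [ [] ]
allWords (suc n) = map (true ∷_) (allWords n) ++ map (false ∷_) (allWords n)

∈-allWords : (xs : Vec Bool n) → xs ∈ allWords n
∈-allWords []           = here refl
∈-allWords (true  ∷ xs) = ∈-++⁺ˡ (∈-map⁺ (true ∷_) (∈-allWords xs))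
∈-allWords (false ∷ xs) = ∈-++⁺ʳ _ (∈-map⁺ (false ∷_) (∈-allWords xs))

allWords-unique : ∀ n → Unique (allWords n)
allWords-unique zero    = All.[] AllPairs.∷ AllPairs.[]
allWords-unique (suc n) =
  Unique.++⁺ (Unique.map⁺ ∷-injectiveʳ (allWords-unique n)) (Unique.map⁺ ∷-injectiveʳ (allWords-unique n)) disjoint
  where
  ∷-injectiveʳ : ∀ {x} {xs ys : Vec Bool n} → x ∷ xs ≡ x ∷ ys → xs ≡ ys
  ∷-injectiveʳ refl = refl
  disjoint : Disjoint (map (true ∷_) (allWords n)) (map (false ∷_) (allWords n))
  disjoint (∈t , ∈f) with ∈-map⁻ (true ∷_) ∈t | ∈-map⁻ (false ∷_) ∈f
  ... | _ , _ , refl | _ , _ , ()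

-- The rule u (k + 1) = nand (u k) (u (k + 2))

nand : Bool → Bool → Bool
nand x y = not (x ∧ y)

NandAt : (ℕ → Bool) → ℕ → Set
NandAt u k = u (suc k) ≡ nand (u k) (u (suc (suc k)))

Good : (ℕ → Bool) → Set
Good u = ∀ k → NandAt u k

good-shift : ∀ i → Good u → Good (shift i u)
good-shift i G k = G (k + i)

good-≗ : u ≗ v → Good u → Good v
good-≗ u≗v G k = trans (sym (u≗v _)) (trans (G k) (cong₂ nand (u≗v _) (u≗v _)))

good-periodic : 1 ≤ p → Periodic u p → (∀ k → k < p → NandAt u k) → Good u
good-periodic {p = p} {u = u} 1≤p P below k = begin
  u (suc k)                        ≡⟨ periodic-+% P 1 k ⟨
  u (suc (k % p))                  ≡⟨ below (k % p) (m%n<n k p) ⟩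
  nand (u (k % p)) (u (2 + k % p)) ≡⟨ cong₂ nand (periodic-% P k) (periodic-+% P 2 k) ⟩
  nand (u k) (u (2 + k))           ∎
  where
  open ≡-Reasoning
  instance _ = >-nonZero 1≤p

good-eventually : 1 ≤ ℓ → Periodic u ℓ → (∀ k → n₀ ≤ k → NandAt u k) → Good u
good-eventually {ℓ = ℓ} {u = u} {n₀ = n₀} 1≤ℓ P tail k = begin
  u (suc k)                                  ≡⟨ periodic-+* P (suc k) n₀ ⟨
  u (suc k + n₀ * ℓ)                         ≡⟨ tail (k + n₀ * ℓ) (≤-+* k n₀ 1≤ℓ) ⟩
  nand (u (k + n₀ * ℓ)) (u (2 + k + n₀ * ℓ)) ≡⟨ cong₂ nand (periodic-+* P k n₀) (periodic-+* P (2 + k) n₀) ⟩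
  nand (u k) (u (2 + k))                     ∎
  where open ≡-Reasoning

rule : Bool → Bool → Bool → Bool
rule x y z = ⌊ y Bool.≟ nand x z ⌋

rule-sound : ∀ x y z → T (rule x y z) → y ≡ nand x z
rule-sound x y z = toWitness {a? = y Bool.≟ nand x z}

rule-complete : ∀ x y z → y ≡ nand x z → T (rule x y z)
rule-complete x y z = fromWitness {a? = y Bool.≟ nand x z}

-- Checks the rule at every letter of the word x y zs a b that has two neighbours.
ruleAlong : Bool → Bool → Vec Bool n → Bool → Bool → Bool
ruleAlong x y []       a b = rule x y a ∧ rule y a b
ruleAlong x y (z ∷ zs) a b = rule x y z ∧ ruleAlong y z zs a b

goodᵇ : Vec Bool n → Bool
goodᵇ []           = false
goodᵇ (_ ∷ [])     = false
goodᵇ (a ∷ b ∷ xs) = ruleAlong a b xs a b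

private
  ∧⁻ : ∀ {x y} → T (x ∧ y) → T x × T y
  ∧⁻ = Equivalence.to T-∧

  ∧⁺ : ∀ {x y} → T x → T y → T (x ∧ y)
  ∧⁺ tx ty = Equivalence.from T-∧ (tx , ty)

RuleAlongPrefix : ℕ → (ℕ → Bool) → Set
RuleAlongPrefix n s = T (ruleAlong (s 0) (s 1) (prefix n (s ∘ suc ∘ suc)) (s (2 + n)) (s (3 + n)))

ruleAlong-sound : ∀ n s → RuleAlongPrefix n s → ∀ k → k < 2 + n → NandAt s k
ruleAlong-sound zero    s t 0             _              = rule-sound (s 0) (s 1) (s 2) (proj₁ (∧⁻ t))
ruleAlong-sound zero    s t 1             _              = rule-sound (s 1) (s 2) (s 3) (proj₂ (∧⁻ t))
ruleAlong-sound zero    s t (suc (suc k)) (s≤s (s≤s ()))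
ruleAlong-sound (suc n) s t zero          _              = rule-sound (s 0) (s 1) (s 2) (proj₁ (∧⁻ t))
ruleAlong-sound (suc n) s t (suc k)       (s≤s k<)       = ruleAlong-sound n (s ∘ suc) (proj₂ (∧⁻ t)) k k<

ruleAlong-complete : ∀ n s → (∀ k → k < 2 + n → NandAt s k) → RuleAlongPrefix n s
ruleAlong-complete zero    s h =
  ∧⁺ (rule-complete (s 0) (s 1) (s 2) (h 0 z<s)) (rule-complete (s 1) (s 2) (s 3) (h 1 (s≤s z<s)))
ruleAlong-complete (suc n) s h =
  ∧⁺ (rule-complete (s 0) (s 1) (s 2) (h 0 z<s)) (ruleAlong-complete n (s ∘ suc) (λ k k< → h (suc k) (s≤s k<)))

private
  goodᵇ≡ruleAlong : (xs : Vec Bool (2 + n)) → let s = cycle xs in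
    goodᵇ xs ≡ ruleAlong (s 0) (s 1) (prefix n (s ∘ suc ∘ suc)) (s (2 + n)) (s (3 + n))
  goodᵇ≡ruleAlong {n = n} xs = trans (cong goodᵇ (sym (prefix-cycle xs)))
    (cong₂ (ruleAlong (s 0) (s 1) (prefix n (s ∘ suc ∘ suc))) (sym (cycle-periodic xs 0)) (sym (cycle-periodic xs 1)))
    where s = cycle xs

goodᵇ-sound : (xs : Vec Bool n) → T (goodᵇ xs) → Good (cycle xs)
goodᵇ-sound []       ()
goodᵇ-sound (_ ∷ []) ()
goodᵇ-sound {n = suc (suc n)} xs t =
  good-periodic z<s (cycle-periodic xs) (ruleAlong-sound n (cycle xs) (subst T (goodᵇ≡ruleAlong xs) t))

goodᵇ-complete : 1 ≤ n → (xs : Vec Bool n) → Good (cycle xs) → T (goodᵇ xs)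
goodᵇ-complete {n = 1} _ (x ∷ []) G = x≢nand-x-x x (G 0)
  where
  x≢nand-x-x : ∀ x → ¬ x ≡ nand x x
  x≢nand-x-x true  ()
  x≢nand-x-x false ()
goodᵇ-complete {n = suc (suc n)} _ xs G =
  subst T (sym (goodᵇ≡ruleAlong xs)) (ruleAlong-complete n (cycle xs) (λ k _ → G k))

goodWords : (n : ℕ) → List (Vec Bool n)
goodWords n = filterᵇ goodᵇ (allWords n)

∈-goodWords⁻ : (word : Vec Bool n) → word ∈ goodWords n → Good (cycle word)
∈-goodWords⁻ word word∈ = goodᵇ-sound word (proj₂ (∈-filter⁻ (Bool.T? ∘ goodᵇ) {xs = allWords _} word∈))

∈-goodWords⁺ : 1 ≤ n → (word : Vec Bool n) → Good (cycle word) → word ∈ goodWords n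
∈-goodWords⁺ 1≤n word G = ∈-filter⁺ (Bool.T? ∘ goodᵇ) (∈-allWords word) (goodᵇ-complete 1≤n word G)

count : (n : ℕ) → (Vec Bool n → Bool) → ℕ
count n P = length (filterᵇ P (allWords n))

count-suc : ∀ n P → count (suc n) P ≡ count n (P ∘ (true ∷_)) + count n (P ∘ (false ∷_))
count-suc n P = begin
  length (filterᵇ P (map (true ∷_) W ++ map (false ∷_) W))
    ≡⟨ cong length (filter-++ _ (map (true ∷_) W) _) ⟩
  length (filterᵇ P (map (true ∷_) W) ++ filterᵇ P (map (false ∷_) W))
    ≡⟨ length-++ (filterᵇ P (map (true ∷_) W)) ⟩
  length (filterᵇ P (map (true ∷_) W)) + length (filterᵇ P (map (false ∷_) W))
    ≡⟨ cong₂ _+_ (count-map true) (count-map false) ⟩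
  count n (P ∘ (true ∷_)) + count n (P ∘ (false ∷_)) ∎
  where
  open ≡-Reasoning
  W = allWords n
  count-map : ∀ x → length (filterᵇ P (map (x ∷_) W)) ≡ count n (P ∘ (x ∷_))
  count-map x = trans (cong length (filterᵇ-map P (x ∷_) W)) (length-map (x ∷_) (filterᵇ (P ∘ (x ∷_)) W))

count-false : ∀ n → count n (λ _ → false) ≡ 0
count-false n = cong length (filter-none _ (All.universal (λ _ ()) (allWords n)))

extensions : ℕ → Bool → Bool → Bool → Bool → ℕ
extensions n x y a b = count n (λ zs → ruleAlong x y zs a b)

module _ (a b : Bool) where

  private
    e : ℕ → Bool → Bool → ℕ
    e n x y = extensions n x y a b

  -- After the letters x y the next letter z must satisfy y = nand x z: there is no such z
  -- after 0 0, any z works after 0 1, only z = 0 after 1 1 and only z = 1 after 1 0.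
  extensions-ff : ∀ n → e n false false ≡ 0
  extensions-ff zero    = refl
  extensions-ff (suc n) = trans (count-suc n _) (cong₂ _+_ (count-false n) (count-false n))

  extensions-ft : ∀ n → e (suc n) false true ≡ e n true true + e n true false
  extensions-ft n = count-suc n _

  extensions-tt : ∀ n → e (suc n) true true ≡ e n true false
  extensions-tt n = trans (count-suc n _) (cong (_+ e n true false) (count-false n))

  extensions-tf : ∀ n → e (suc n) true false ≡ e n false true
  extensions-tf n = trans (count-suc n _) (trans (cong (e n false true +_) (count-false n)) (+-identityʳ _))

  extensions-rec : ∀ n x y → e (3 + n) x y ≡ e (1 + n) x y + e n x y
  extensions-rec n false false = begin
    e (3 + n) false false                   ≡⟨ extensions-ff (3 + n) ⟩
    0                                       ≡⟨ cong₂ _+_ (extensions-ff (1 + n)) (extensions-ff n) ⟨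
    e (1 + n) false false + e n false false ∎
    where open ≡-Reasoning
  extensions-rec n false true = begin
    e (3 + n) false true                        ≡⟨ extensions-ft (2 + n) ⟩
    e (2 + n) true true + e (2 + n) true false  ≡⟨ cong₂ _+_ (extensions-tt (1 + n)) (extensions-tf (1 + n)) ⟩
    e (1 + n) true false + e (1 + n) false true ≡⟨ cong (_+ e (1 + n) false true) (extensions-tf n) ⟩
    e n false true + e (1 + n) false true       ≡⟨ +-comm (e n false true) _ ⟩
    e (1 + n) false true + e n false true       ∎
    where open ≡-Reasoning
  extensions-rec n true true = begin
    e (3 + n) true true                 ≡⟨ extensions-tt (2 + n) ⟩
    e (2 + n) true false                ≡⟨ extensions-tf (1 + n) ⟩
    e (1 + n) false true                ≡⟨ extensions-ft n ⟩
    e n true true + e n true false      ≡⟨ cong (e n true true +_) (extensions-tt n) ⟨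
    e n true true + e (1 + n) true true ≡⟨ +-comm (e n true true) _ ⟩
    e (1 + n) true true + e n true true ∎
    where open ≡-Reasoning
  extensions-rec n true false = begin
    e (3 + n) true false                       ≡⟨ extensions-tf (2 + n) ⟩
    e (2 + n) false true                       ≡⟨ extensions-ft (1 + n) ⟩
    e (1 + n) true true + e (1 + n) true false ≡⟨ cong₂ _+_ (extensions-tt n) (extensions-tf n) ⟩
    e n true false + e n false true            ≡⟨ +-comm (e n true false) _ ⟩
    e n false true + e n true false            ≡⟨ cong (_+ e n true false) (extensions-tf n) ⟨
    e (1 + n) true false + e n true false      ∎
    where open ≡-Reasoning

-- The trace of the (n + 2)-th power of the transfer matrix on pairs of consecutive letters;
-- like each of its entries (extensions-rec), it satisfies the Perrin recurrence.
trace : ℕ → ℕ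
trace n = (extensions n true true true true + extensions n true false true false)
        + (extensions n false true false true + extensions n false false false false)

count-goodᵇ-trace : ∀ n → count (2 + n) goodᵇ ≡ trace n
count-goodᵇ-trace n = trans (count-suc (1 + n) goodᵇ) (cong₂ _+_ (count-suc n _) (count-suc n _))

trace-rec : ∀ n → trace (3 + n) ≡ trace (1 + n) + trace n
trace-rec n rewrite extensions-rec true true n true true | extensions-rec true false n true false
                  | extensions-rec false true n false true | extensions-rec false false n false false
  = shuffle (extensions (1 + n) true true true true)     (extensions n true true true true)
            (extensions (1 + n) true false true false)   (extensions n true false true false)
            (extensions (1 + n) false true false true)   (extensions n false true false true)
            (extensions (1 + n) false false false false) (extensions n false false false false)
  where
  shuffle : ∀ a a′ b b′ c c′ d d′ →
            a + a′ + (b + b′) + (c + c′ + (d + d′)) ≡ a + b + (c + d) + (a′ + b′ + (c′ + d′))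
  shuffle a a′ b b′ c c′ d d′ =
    trans (cong₂ _+_ (interchange a a′ b b′) (interchange c c′ d d′)) (interchange (a + b) (a′ + b′) (c + d) (c′ + d′))

trace≡Q : ∀ n → trace n ≡ Q (2 + n)
trace≡Q n = proj₁ (three n)
  where
  three : ∀ n → trace n ≡ Q (2 + n) × trace (1 + n) ≡ Q (3 + n) × trace (2 + n) ≡ Q (4 + n)
  three zero    = refl , refl , refl
  three (suc n) with three n
  ... | t₀ , t₁ , t₂ = t₁ , t₂ , trans (trace-rec n) (cong₂ _+_ t₁ t₀)

length-goodWords : 1 ≤ n → length (goodWords n) ≡ Q n
length-goodWords {n = 1}           _ = refl
length-goodWords {n = suc (suc n)} _ = trans (count-goodᵇ-trace n) (trace≡Q n)

-- Necklaces and the divisor-sum identity for Q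

cycle⇝? : (xs ys : Vec Bool d) → Dec (cycle xs ⇝ cycle ys)
cycle⇝? {zero}  [] [] = yes ⇝-refl
cycle⇝? {suc d} xs ys =
  map′ rotation⇒⇝ ⇝⇒rotation (anyUpTo? (λ i → Vec.≡-dec Bool._≟_ (prefix (suc d) (shift i (cycle xs))) ys) (suc d))
  where
  Rotation = ∃ λ i → i < suc d × prefix (suc d) (shift i (cycle xs)) ≡ ys
  rotation⇒⇝ : Rotation → cycle xs ⇝ cycle ys
  rotation⇒⇝ (i , _ , refl) = i , λ n → sym (cycle-prefix z<s (periodic-shift i (cycle-periodic xs)) n)
  ⇝⇒rotation : cycle xs ⇝ cycle ys → Rotation
  ⇝⇒rotation (t , h) = t % suc d , m%n<n t (suc d) ,
    trans (prefix-≗ (λ n → trans (shift-% {u = cycle xs} (cycle-periodic xs) t n) (h n))) (prefix-cycle ys)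

primitive? : (xs : Vec Bool d) → Dec (LeastPeriod (cycle xs) d)
primitive? {zero}  [] = no λ { ((() , _) , _) }
primitive? {suc d} xs = leastPeriod? (z<s , cycle-periodic xs) (suc d)

necklaces : (d : ℕ) → List (Vec Bool d)
necklaces d = deduplicate cycle⇝? (filter primitive? (goodWords d))

module _ {r : Vec Bool d} (r∈ : r ∈ necklaces d) where

  private
    r∈primitive = ∈-filter⁻ primitive? {xs = goodWords d} (∈-deduplicate⁻ cycle⇝? _ r∈)

  necklace-leastPeriod : LeastPeriod (cycle r) d
  necklace-leastPeriod = proj₂ r∈primitive

  necklace-good : Good (cycle r)
  necklace-good = ∈-goodWords⁻ r (proj₁ r∈primitive)

necklaces-distinct : ∀ d → AllPairs (λ r r′ → ¬ cycle r ⇝ cycle r′) (necklaces d)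
necklaces-distinct d = deduplicate-allPairs cycle⇝? _

necklace-complete : Good u → LeastPeriod u d → ∃ λ r → r ∈ necklaces d × cycle r ⇝ u
necklace-complete {u = u} {d = d} G L@((1≤d , P) , _) =
  find (Any.deduplicate⁺ cycle⇝? ⇝-trans (lose word∈ (⇝-≗ cycle-word ⇝-refl)))
  where
  word = prefix d u
  cycle-word : cycle word ≗ u
  cycle-word = cycle-prefix 1≤d P
  word∈ : word ∈ filter primitive? (goodWords d)
  word∈ = ∈-filter⁺ primitive? (∈-goodWords⁺ 1≤d word (good-≗ (λ n → sym (cycle-word n)) G))
                                (leastPeriod-≗ (λ n → sym (cycle-word n)) L)

orbit : (ℓ : ℕ) → Vec Bool d → ℕ → Vec Bool ℓ
orbit ℓ r i = prefix ℓ (shift i (cycle r))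

orbits : (ℓ d : ℕ) → List (Vec Bool ℓ)
orbits ℓ d = concatMap (λ r → applyUpTo (orbit ℓ r) d) (necklaces d)

orbitWords : (ℓ : ℕ) → List (Vec Bool ℓ)
orbitWords ℓ = concatDivUpTo (orbits ℓ) ℓ ℓ

length-orbits : ∀ ℓ d → length (orbits ℓ d) ≡ length (necklaces d) * d
length-orbits ℓ d = length-concatMap-const _ (necklaces d) (λ r → length-applyUpTo (orbit ℓ r) d)

∈-orbits⁺ : ∀ {r} → r ∈ necklaces d → i < d → orbit ℓ r i ∈ orbits ℓ d
∈-orbits⁺ {d = d} {ℓ = ℓ} {r = r} r∈ i<d =
  ∈-concatMap⁺ (λ r → applyUpTo (orbit ℓ r) d) (Any.map (λ { refl → ∈-applyUpTo⁺ (orbit ℓ r) i<d }) r∈)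

∈-orbits⁻ : ∀ {y} → y ∈ orbits ℓ d → ∃ λ r → r ∈ necklaces d × ∃ λ i → i < d × y ≡ orbit ℓ r i
∈-orbits⁻ {ℓ = ℓ} {d = d} y∈ with find (∈-concatMap⁻ (λ r → applyUpTo (orbit ℓ r) d) y∈)
... | r , r∈ , y∈′ with ∈-applyUpTo⁻ (orbit ℓ r) y∈′
...   | i , i<d , y≡ = r , r∈ , i , i<d , y≡

module _ {ℓ} (1≤ℓ : 1 ≤ ℓ) where

  module _ (1≤d : 1 ≤ d) (d∣ℓ : d ∣ ℓ) where

    cycle-orbit : (r : Vec Bool d) → cycle (orbit ℓ r i) ≗ shift i (cycle r)
    cycle-orbit {i = i} r = cycle-prefix 1≤ℓ (periodic-shift i (periodic-∣ (cycle-periodic r) d∣ℓ))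

    orbit-≡⇒shift-≗ : (r r′ : Vec Bool d) → orbit ℓ r i ≡ orbit ℓ r′ i′ → shift i (cycle r) ≗ shift i′ (cycle r′)
    orbit-≡⇒shift-≗ r r′ eq n = trans (sym (cycle-orbit r n)) (trans (cong (λ xs → cycle xs n) eq) (cycle-orbit r′ n))

    orbit-leastPeriod : ∀ {r} → r ∈ necklaces d → LeastPeriod (cycle (orbit ℓ r i)) d
    orbit-leastPeriod {i = i} {r = r} r∈ =
      leastPeriod-≗ (λ n → sym (cycle-orbit r n)) (leastPeriod-shift i (necklace-leastPeriod r∈))

    orbit-good : ∀ {r} → r ∈ necklaces d → Good (cycle (orbit ℓ r i))
    orbit-good {i = i} {r = r} r∈ =
      good-≗ (λ n → sym (cycle-orbit r n)) (good-shift {u = cycle r} i (necklace-good r∈))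

    orbits-unique : Unique (orbits ℓ d)
    orbits-unique = Unique.concat⁺ (All.map⁺ (All.tabulate rotations-unique))
                                   (AllPairs.map⁺ (AllPairs.map disjoint (necklaces-distinct d)))
      where
      rotations-unique : ∀ {r} → r ∈ necklaces d → Unique (applyUpTo (orbit ℓ r) d)
      rotations-unique {r} r∈ = Unique.applyUpTo⁺₁ (orbit ℓ r) d λ i<j j<d eq →
        <⇒≢ i<j (leastPeriod-shift-injective (necklace-leastPeriod r∈) (<-trans i<j j<d) j<d (orbit-≡⇒shift-≗ r r eq))
      disjoint : ∀ {r r′} → ¬ cycle r ⇝ cycle r′ → Disjoint (applyUpTo (orbit ℓ r) d) (applyUpTo (orbit ℓ r′) d)
      disjoint {r} {r′} r↛r′ (y∈ , y∈′) with ∈-applyUpTo⁻ (orbit ℓ r) y∈ | ∈-applyUpTo⁻ (orbit ℓ r′) y∈′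
      ... | i , _ , refl | i′ , _ , eq =
        r↛r′ (⇝-trans (⇝-≗ (orbit-≡⇒shift-≗ r r′ eq) (⇝-shift i)) (⇝-sym (1≤d , cycle-periodic r′) (⇝-shift i′)))

  orbitWords-unique : Unique (orbitWords ℓ)
  orbitWords-unique = allPairs-concatDivUpTo (orbits ℓ) ℓ orbits-unique across ℓ
    where
    across : ∀ {d d′ x y} → d < d′ → 1 ≤ d → d ∣ ℓ → d′ ∣ ℓ → x ∈ orbits ℓ d → y ∈ orbits ℓ d′ → x ≢ y
    across d<d′ 1≤d d∣ℓ d′∣ℓ x∈ y∈ x≡y with ∈-orbits⁻ x∈ | ∈-orbits⁻ y∈
    ... | r , r∈ , i , _ , x≡ | r′ , r′∈ , i′ , _ , y≡ =
      <⇒≢ d<d′ (leastPeriod-unique (orbit-leastPeriod 1≤d d∣ℓ r∈)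
                  (subst (λ xs → LeastPeriod (cycle xs) _) (trans (sym y≡) (trans (sym x≡y) x≡))
                         (orbit-leastPeriod (≤-trans 1≤d (<⇒≤ d<d′)) d′∣ℓ r′∈)))

  goodWords⊆orbitWords : goodWords ℓ ⊆ orbitWords ℓ
  goodWords⊆orbitWords {xs} xs∈ with leastPeriod-exists (1≤ℓ , cycle-periodic xs)
  ... | d , L@((1≤d , _) , _) with necklace-complete (∈-goodWords⁻ xs xs∈) L
  ...   | r , r∈ , (t , r⇝xs) =
    subst (_∈ orbitWords ℓ) orbit≡xs (∈-concatDivUpTo⁺ (orbits ℓ) ℓ 1≤d (∣⇒≤ d∣ℓ) d∣ℓ (∈-orbits⁺ r∈ (m%n<n t d)))
    where
    instance
      _ = >-nonZero 1≤d
      _ = >-nonZero 1≤ℓ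
    d∣ℓ = leastPeriod-∣ L (1≤ℓ , cycle-periodic xs)
    orbit≡xs : orbit ℓ r (t % d) ≡ xs
    orbit≡xs = trans (prefix-≗ (λ n → trans (shift-% (cycle-periodic r) t n) (r⇝xs n))) (prefix-cycle xs)

  orbitWords⊆goodWords : orbitWords ℓ ⊆ goodWords ℓ
  orbitWords⊆goodWords y∈ with ∈-concatDivUpTo⁻ (orbits ℓ) ℓ ℓ y∈
  ... | d , 1≤d , _ , d∣ℓ , y∈orbits with ∈-orbits⁻ y∈orbits
  ...   | r , r∈ , i , _ , y≡ = subst (_∈ goodWords ℓ) (sym y≡) (∈-goodWords⁺ 1≤ℓ _ (orbit-good 1≤d d∣ℓ r∈))

  Q≡length-orbitWords : Q ℓ ≡ length (orbitWords ℓ)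
  Q≡length-orbitWords = trans (sym (length-goodWords 1≤ℓ))
    (unique-⊆⊇⇒length-≡ (Unique.filter⁺ (Bool.T? ∘ goodᵇ) (allWords-unique ℓ)) orbitWords-unique
                          goodWords⊆orbitWords orbitWords⊆goodWords)

-- The recursion defining N′

private
  toℚ-mkℚ : ∀ n → toℚ n ≡ mkℚ (ℤ.+ n) 0 (coprime-sym (1-coprimeTo n))
  toℚ-mkℚ n = ℚ.normalize-coprime (coprime-sym (1-coprimeTo n))

toℚ-+ : ∀ m n → toℚ (m + n) ≡ toℚ m ℚ.+ toℚ n
toℚ-+ m n rewrite toℚ-mkℚ m | toℚ-mkℚ n =
  sym (ℚ./-cong {p₂ = ℤ.+ (m + n)} (cong₂ ℤ._+_ (ℤ.*-identityʳ (ℤ.+ m)) (ℤ.*-identityʳ (ℤ.+ n))) refl)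

toℚ-* : ∀ m n → toℚ (m * n) ≡ toℚ m ℚ.* toℚ n
toℚ-* m n rewrite toℚ-mkℚ m | toℚ-mkℚ n = sym (ℚ./-cong {p₂ = ℤ.+ (m * n)} (sym (ℤ.pos-* m n)) refl)

toℚ-inverse : ∀ k → toℚ (suc k) ℚ.* (ℤ.+ 1 ℚ./ suc k) ≡ 1ℚ
toℚ-inverse k rewrite toℚ-mkℚ (suc k) | ℚ.normalize-coprime {1} {k} (1-coprimeTo (suc k)) =
  ℚ.*-inverseʳ (mkℚ (ℤ.+ suc k) 0 (coprime-sym (1-coprimeTo (suc k))))

[S+mℓ-S]/ℓ≡m : ∀ S m k → (S ℚ.+ toℚ (m * suc k) ℚ.- S) ℚ.* (ℤ.+ 1 ℚ./ suc k) ≡ toℚ m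
[S+mℓ-S]/ℓ≡m S m k = begin
  (S ℚ.+ toℚ (m * suc k) ℚ.- S) ℚ.* I   ≡⟨ cong (ℚ._* I) (xyx⁻¹≈y S _) ⟩
  toℚ (m * suc k) ℚ.* I                 ≡⟨ cong (ℚ._* I) (toℚ-* m (suc k)) ⟩
  toℚ m ℚ.* toℚ (suc k) ℚ.* I           ≡⟨ ℚ.*-assoc (toℚ m) _ I ⟩
  toℚ m ℚ.* (toℚ (suc k) ℚ.* I)         ≡⟨ cong (toℚ m ℚ.*_) (toℚ-inverse k) ⟩
  toℚ m ℚ.* 1ℚ                          ≡⟨ ℚ.*-identityʳ _ ⟩
  toℚ m                                 ∎
  where
  open ≡-Reasoning
  I = ℤ.+ 1 ℚ./ suc k

sumDivUpTo-cong : ∀ {f g : ℕ → ℚ} ℓ k → (∀ d → 1 ≤ d → d ≤ k → f d ≡ g d) → sumDivUpTo f ℓ k ≡ sumDivUpTo g ℓ k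
sumDivUpTo-cong ℓ zero    _   = refl
sumDivUpTo-cong ℓ (suc k) f≡g with suc k ∣? ℓ
... | yes _ = cong₂ ℚ._+_ (sumDivUpTo-cong ℓ k (λ d 1≤d d≤k → f≡g d 1≤d (m≤n⇒m≤1+n d≤k)))
                          (f≡g (suc k) (s≤s z≤n) ≤-refl)
... | no  _ = sumDivUpTo-cong ℓ k (λ d 1≤d d≤k → f≡g d 1≤d (m≤n⇒m≤1+n d≤k))

sumDivUpTo-self : ∀ f k → sumDivUpTo f (suc k) (suc k) ≡ sumDivUpTo f (suc k) k ℚ.+ f (suc k)
sumDivUpTo-self f k with suc k ∣? suc k
... | yes _ = refl
... | no ∤  = contradiction ∣-refl ∤

toℚ-length-concatDivUpTo : ∀ (f : ℕ → List A) ℓ k →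
  toℚ (length (concatDivUpTo f ℓ k)) ≡ sumDivUpTo (toℚ ∘ length ∘ f) ℓ k
toℚ-length-concatDivUpTo f ℓ zero    = refl
toℚ-length-concatDivUpTo f ℓ (suc k) with suc k ∣? ℓ
... | no  _ = toℚ-length-concatDivUpTo f ℓ k
... | yes _ = begin
  toℚ (length (concatDivUpTo f ℓ k ++ f (suc k)))             ≡⟨ cong toℚ (length-++ (concatDivUpTo f ℓ k)) ⟩
  toℚ (length (concatDivUpTo f ℓ k) + length (f (suc k)))     ≡⟨ toℚ-+ (length (concatDivUpTo f ℓ k)) _ ⟩
  toℚ (length (concatDivUpTo f ℓ k)) ℚ.+ toℚ (length (f (suc k)))
    ≡⟨ cong (ℚ._+ toℚ (length (f (suc k)))) (toℚ-length-concatDivUpTo f ℓ k) ⟩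
  sumDivUpTo (toℚ ∘ length ∘ f) ℓ k ℚ.+ toℚ (length (f (suc k))) ∎
  where open ≡-Reasoning

N'aux-fuel : ∀ f f′ d → d ≤ f → d ≤ f′ → N'aux f d ≡ N'aux f′ d
N'aux-fuel zero    zero     d       _         _          = refl
N'aux-fuel zero    (suc f′) zero    _         _          = refl
N'aux-fuel (suc f) zero     zero    _         _          = refl
N'aux-fuel (suc f) (suc f′) zero    _         _          = refl
N'aux-fuel (suc f) (suc f′) (suc k) (s≤s k≤f) (s≤s k≤f′) =
  cong (λ S → (toℚ (Q (suc k)) ℚ.- S) ℚ.* (ℤ.+ 1 ℚ./ suc k)) (sumDivUpTo-cong (suc k) k λ d _ d≤k →
    cong (toℚ d ℚ.*_) (N'aux-fuel f f′ d (≤-trans d≤k k≤f) (≤-trans d≤k k≤f′)))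

divisorSum≡Q⇒N'≡ : (c : ℕ → ℕ) → (∀ ℓ → 1 ≤ ℓ → sumDivUpTo (λ d → toℚ (c d * d)) ℓ ℓ ≡ toℚ (Q ℓ)) →
                   ∀ ℓ → 1 ≤ ℓ → N' ℓ ≡ toℚ (c ℓ)
divisorSum≡Q⇒N'≡ c divisor-sum ℓ = below (suc ℓ) ℓ ≤-refl
  where
  below : ∀ F ℓ → ℓ < F → 1 ≤ ℓ → N' ℓ ≡ toℚ (c ℓ)
  below (suc F) (suc k) (s≤s k<F) _ = begin
    (toℚ (Q (suc k)) ℚ.- sumDivUpTo (λ d → toℚ d ℚ.* N'aux k d) (suc k) k) ℚ.* (ℤ.+ 1 ℚ./ suc k)
      ≡⟨ cong (λ T → (toℚ (Q (suc k)) ℚ.- T) ℚ.* (ℤ.+ 1 ℚ./ suc k)) lower-sum ⟩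
    (toℚ (Q (suc k)) ℚ.- S) ℚ.* (ℤ.+ 1 ℚ./ suc k)
      ≡⟨ cong (λ T → (T ℚ.- S) ℚ.* (ℤ.+ 1 ℚ./ suc k))
              (trans (sym (divisor-sum (suc k) (s≤s z≤n))) (sumDivUpTo-self _ k)) ⟩
    (S ℚ.+ toℚ (c (suc k) * suc k) ℚ.- S) ℚ.* (ℤ.+ 1 ℚ./ suc k)
      ≡⟨ [S+mℓ-S]/ℓ≡m S (c (suc k)) k ⟩
    toℚ (c (suc k)) ∎
    where
    open ≡-Reasoning
    S = sumDivUpTo (λ d → toℚ (c d * d)) (suc k) k
    lower-sum : sumDivUpTo (λ d → toℚ d ℚ.* N'aux k d) (suc k) k ≡ S
    lower-sum = sumDivUpTo-cong (suc k) k λ d 1≤d d≤k → begin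
      toℚ d ℚ.* N'aux k d ≡⟨ cong (toℚ d ℚ.*_) (N'aux-fuel k d d d≤k ≤-refl) ⟩
      toℚ d ℚ.* N' d      ≡⟨ cong (toℚ d ℚ.*_) (below F d (≤-<-trans d≤k k<F) 1≤d) ⟩
      toℚ d ℚ.* toℚ (c d) ≡⟨ ℚ.*-comm (toℚ d) _ ⟩
      toℚ (c d) ℚ.* toℚ d ≡⟨ toℚ-* (c d) d ⟨
      toℚ (c d * d)       ∎

N'≡length-necklaces : ∀ ℓ → 1 ≤ ℓ → N' ℓ ≡ toℚ (length (necklaces ℓ))
N'≡length-necklaces = divisorSum≡Q⇒N'≡ (length ∘ necklaces) λ ℓ 1≤ℓ → sym (begin
  toℚ (Q ℓ)                                             ≡⟨ cong toℚ (Q≡length-orbitWords 1≤ℓ) ⟩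
  toℚ (length (orbitWords ℓ))                           ≡⟨ toℚ-length-concatDivUpTo (orbits ℓ) ℓ ℓ ⟩
  sumDivUpTo (toℚ ∘ length ∘ orbits ℓ) ℓ ℓ              ≡⟨ sumDivUpTo-cong ℓ ℓ (λ d _ _ → cong toℚ (length-orbits ℓ d)) ⟩
  sumDivUpTo (λ d → toℚ (length (necklaces d) * d)) ℓ ℓ ∎)
  where open ≡-Reasoning

-- The recurrence of 𝒲^{1,b}

-- E m = nand (E (m ∸ 1)) (E (m ∸ b)) for all m ≥ b = suc c, written with m = suc (n + c).
record NandRecurrence (c : ℕ) (E : ℕ → Bool) : Set where
  field
    step : ∀ n → E (suc (n + c)) ≡ nand (E (n + c)) (E n)

open NandRecurrence

nandRecurrence-shift : ∀ t → NandRecurrence c E → NandRecurrence c (shift t E)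
nandRecurrence-shift {c = c} {E = E} t R .step n = begin
  E (suc (n + c + t))              ≡⟨ cong (λ k → E (suc k)) (xy∙z≈xz∙y n c t) ⟩
  E (suc (n + t + c))              ≡⟨ step R (n + t) ⟩
  nand (E (n + t + c)) (E (n + t)) ≡⟨ cong (λ k → nand (E k) (E (n + t))) (xy∙z≈xz∙y n t c) ⟩
  nand (E (n + c + t)) (E (n + t)) ∎
  where open ≡-Reasoning

nandRecurrence-unique : NandRecurrence c E → NandRecurrence c F → (∀ m → m ≤ c → E m ≡ F m) → E ≗ F
nandRecurrence-unique {c = c} {E = E} {F = F} RE RF seed = <-rec (λ m → E m ≡ F m) agree
  where
  agree : ∀ m → (∀ {k} → k < m → E k ≡ F k) → E m ≡ F m
  agree m below with m ≤? c
  ... | yes m≤c = seed m m≤c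
  ... | no  m≰c = subst (λ m → E m ≡ F m) m≡ (begin
    E (suc (n′ + c))         ≡⟨ step RE n′ ⟩
    nand (E (n′ + c)) (E n′) ≡⟨ cong₂ nand (below n′+c<m) (below (≤-<-trans (m≤m+n n′ c) n′+c<m)) ⟩
    nand (F (n′ + c)) (F n′) ≡⟨ step RF n′ ⟨
    F (suc (n′ + c))         ∎)
    where
    open ≡-Reasoning
    n′ = m ∸ suc c
    m≡ : suc (n′ + c) ≡ m
    m≡ = trans (sym (+-suc n′ c)) (m∸n+n≡m (≰⇒> m≰c))
    n′+c<m : n′ + c < m
    n′+c<m = subst (n′ + c <_) m≡ ≤-refl

module _ {c} (S : Vec Bool (suc c)) where

  private
    b = suc c

  extAux-fuel : ∀ {f f′ m} → m < f → m < f′ → extAux b S f m ≡ extAux b S f′ m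
  extAux-fuel {suc f} {suc f′} {m} (s≤s m≤f) (s≤s m≤f′) with m <? b
  ... | yes _  = refl
  ... | no m≮b = cong₂ nand (extAux-fuel (≤-trans m∸1<m m≤f) (≤-trans m∸1<m m≤f′))
                            (extAux-fuel (≤-trans m∸b<m m≤f) (≤-trans m∸b<m m≤f′))
    where
    b≤m = ≮⇒≥ m≮b
    m∸1<m : m ∸ 1 < m
    m∸1<m = ∸-monoʳ-< {o = 0} z<s (≤-trans (s≤s z≤n) b≤m)
    m∸b<m : m ∸ b < m
    m∸b<m = ∸-monoʳ-< {o = 0} z<s b≤m

  ext-nandRecurrence : NandRecurrence c (ext b S)
  ext-nandRecurrence .step n with suc (n + c) <? b
  ... | yes n+c<c = contradiction (s≤s⁻¹ n+c<c) (<⇒≱ (s≤s (m≤n+m c n)))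
  ... | no  _     = cong (nand (ext b S (n + c)))
    (trans (cong (extAux b S (suc (n + c))) (m+n∸n≡m n c)) (extAux-fuel (s≤s (m≤m+n n c)) ≤-refl))

  ext-seed : ∀ m (m≤c : m ≤ c) → ext b S m ≡ lookup S (fromℕ< (s≤s m≤c))
  ext-seed m m≤c with m <? b
  ... | yes _   = refl
  ... | no  m≮b = contradiction (s≤s m≤c) m≮b

ext-prefix : NandRecurrence c E → ext (suc c) (prefix (suc c) E) ≗ E
ext-prefix {c = c} {E = E} R = nandRecurrence-unique (ext-nandRecurrence (prefix (suc c) E)) R λ m m≤c →
  trans (ext-seed (prefix (suc c) E) m m≤c)
        (trans (Vec.lookup∘tabulate (E ∘ toℕ) (fromℕ< (s≤s m≤c))) (cong E (toℕ-fromℕ< (s≤s m≤c))))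

private
  +-2+ : ∀ j c → j + (2 + c) ≡ 2 + (j + c)
  +-2+ j c = trans (+-suc j (suc c)) (cong suc (+-suc j c))

-- For (c + 2)-periodic sequences E (m ∸ b) = E (m + 1), so the recurrence is the rule of Good.
good⇒nandRecurrence : Good E → Periodic E (2 + c) → NandRecurrence c E
good⇒nandRecurrence {E = E} {c = c} G P .step n =
  trans (G (n + c)) (cong (nand (E (n + c))) (trans (cong E (sym (+-2+ n c))) (P n)))

nandRecurrence⇒good : NandRecurrence c E → Periodic E (2 + c) → Good E
nandRecurrence⇒good {c = c} {E = E} R P = good-eventually {n₀ = c} (s≤s z≤n) P tail
  where
  tail : ∀ k → c ≤ k → NandAt E k
  tail k c≤k = begin
    E (suc k)                        ≡⟨ cong (λ m → E (suc m)) k∸c+c ⟨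
    E (suc (k ∸ c + c))              ≡⟨ step R (k ∸ c) ⟩
    nand (E (k ∸ c + c)) (E (k ∸ c)) ≡⟨ cong₂ nand (cong E k∸c+c) (sym (P (k ∸ c))) ⟩
    nand (E k) (E (k ∸ c + (2 + c))) ≡⟨ cong (λ m → nand (E k) (E m)) (trans (+-2+ (k ∸ c) c) (cong (2 +_) k∸c+c)) ⟩
    nand (E k) (E (2 + k))           ∎
    where
    open ≡-Reasoning
    k∸c+c : k ∸ c + c ≡ k
    k∸c+c = m∸n+n≡m c≤k

module _ {c} {E : ℕ → Bool} (R : NandRecurrence c E) where

  private
    Recurs : ℕ → Set
    Recurs m = E (2 + m + c) ≡ E m

    nand-false : ∀ x → nand x false ≡ true
    nand-false x = cong not (∧-zeroʳ x)

    nand-true⁻ : ∀ {y} → nand true y ≡ true → y ≡ false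
    nand-true⁻ {false} _ = refl

    -- A zero at m forces E (1 + m) = E (1 + m + c) = true, hence E (2 + m + c) = nand true true.
    zero-recurs : ∀ n → E (n + c) ≡ false → Recurs (n + c)
    zero-recurs n e = begin
      E (2 + (n + c) + c)                          ≡⟨ step R (suc (n + c)) ⟩
      nand (E (suc (n + c + c))) (E (suc (n + c))) ≡⟨ cong₂ nand one one′ ⟩
      false                                        ≡⟨ e ⟨
      E (n + c)                                    ∎
      where
      open ≡-Reasoning
      one : E (suc (n + c + c)) ≡ true
      one = trans (step R (n + c)) (trans (cong (nand (E (n + c + c))) e) (nand-false _))
      one′ : E (suc (n + c)) ≡ true
      one′ = trans (step R n) (cong (λ x → nand x (E n)) e)

    recurs-suc : ∀ n → Recurs (n + c + c) → Recurs (suc (n + c + c))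
    recurs-suc n h with E (suc (n + c + c)) in e
    ... | false = trans (zero-recurs (suc n + c) e) e
    ... | true  = begin
      E (3 + m + c)                    ≡⟨ step R (2 + m) ⟩
      nand (E (2 + m + c)) (E (2 + m)) ≡⟨ cong (λ x → nand x (E (2 + m))) h ⟩
      nand (E m) (E (2 + m))           ≡⟨ nand-true (E m) refl ⟩
      true                             ∎
      where
      open ≡-Reasoning
      m = n + c + c
      -- If E m is true then E (1 + m) = true forces a zero at m ∸ c, and so E (2 + m) = nand true true.
      nand-true : ∀ x → E m ≡ x → nand x (E (2 + m)) ≡ true
      nand-true false _  = refl
      nand-true true  eₘ = cong (nand true) (begin
        E (2 + m)                          ≡⟨ step R (suc (n + c)) ⟩
        nand (E (suc m)) (E (suc (n + c))) ≡⟨ cong₂ nand e (trans (step R n) (cong (λ x → nand x (E n)) zero-at)) ⟩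
        false                              ∎)
        where
        zero-at : E (n + c) ≡ false
        zero-at = nand-true⁻ (trans (cong (λ x → nand x (E (n + c))) (sym eₘ)) (trans (sym (step R (n + c))) e))

    -- One of the positions 1 + 2c, 2 + 2c and 3 + 2c carries a zero.
    recurs-base : Recurs (3 + c + c)
    recurs-base with E (1 + c + c) in e₁ | E (2 + c + c) in e₂
    ... | false | _     = recurs-suc 2 (recurs-suc 1 (zero-recurs (1 + c) e₁))
    ... | true  | false = recurs-suc 2 (zero-recurs (2 + c) e₂)
    ... | true  | true  = zero-recurs (3 + c) (trans (zero-recurs 1 zero-at) zero-at)
      where
      zero-at : E (1 + c) ≡ false
      zero-at = nand-true⁻ (trans (cong (λ x → nand x (E (1 + c))) (sym e₁)) (trans (sym (step R (1 + c))) e₂))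

    recurs-all : ∀ n → Recurs (3 + n + c + c)
    recurs-all zero    = recurs-base
    recurs-all (suc n) = recurs-suc (3 + n) (recurs-all n)

  nandRecurrence-eventually-periodic : ∀ m → 3 + c + c ≤ m → E (m + (2 + c)) ≡ E m
  nandRecurrence-eventually-periodic m le = trans (cong E (+-2+ m c)) (subst Recurs m≡ (recurs-all (m ∸ (3 + c + c))))
    where
    m≡ : 3 + (m ∸ (3 + c + c)) + c + c ≡ m
    m≡ = trans (cong (3 +_) (+-assoc (m ∸ (3 + c + c)) c c))
               (trans (x∙yz≈y∙xz 3 (m ∸ (3 + c + c)) (c + c)) (m∸n+n≡m le))

module _ {c} (S : Vec Bool (suc c)) where

  private
    b = suc c

  w-eventually-periodic : ∀ n → 2 + c ≤ n → w b S (n + (2 + c)) ≡ w b S n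
  w-eventually-periodic n 2+c≤n = trans (cong (ext b S) (xy∙z≈xz∙y n (2 + c) b))
                         (nandRecurrence-eventually-periodic (ext-nandRecurrence S) (n + b) bound)
    where
    bound : 3 + c + c ≤ n + b
    bound = subst (_≤ n + b) (cong (2 +_) (+-suc c c)) (+-monoˡ-≤ b 2+c≤n)

  w-good : Periodic (w b S) (2 + c) → Good (w b S)
  w-good = nandRecurrence⇒good (nandRecurrence-shift b (ext-nandRecurrence S))

  w-shift : ∀ t → w b (prefix b (shift t (ext b S))) ≗ shift t (w b S)
  w-shift t n = trans (ext-prefix (nandRecurrence-shift t (ext-nandRecurrence S)) (n + b))
                      (cong (ext b S) (xy∙z≈xz∙y n b t))

w-prefix : Good E → Periodic E (2 + c) → w (suc c) (prefix (suc c) E) ≗ shift (suc c) E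
w-prefix {c = c} G P n = ext-prefix (good⇒nandRecurrence G P) (n + suc c)

-- Periodicities of {1, b}

module _ (c : ℕ) where

  private
    b = suc c

  seed : Vec Bool d → Vec Bool b
  seed r = prefix b (cycle r)

  representatives : ℕ → List (Vec Bool b)
  representatives d = map seed (necklaces d)

  module _ {ℓ} (ℓ∣b+1 : ℓ ∣ suc b) {r : Vec Bool ℓ} (r∈ : r ∈ necklaces ℓ) where

    w-seed : w b (seed r) ≗ shift b (cycle r)
    w-seed = w-prefix (necklace-good r∈) (periodic-∣ (cycle-periodic r) ℓ∣b+1)

    w-seed-leastPeriod : LeastPeriod (w b (seed r)) ℓ
    w-seed-leastPeriod = leastPeriod-≗ (λ n → sym (w-seed n)) (leastPeriod-shift b (necklace-leastPeriod r∈))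

    cycle⇝w-seed : cycle r ⇝ w b (seed r)
    cycle⇝w-seed = ⇝-≗ (λ n → sym (w-seed n)) (⇝-shift b)

    w-seed⇝cycle : w b (seed r) ⇝ cycle r
    w-seed⇝cycle = ⇝-sym (proj₁ (necklace-leastPeriod r∈)) cycle⇝w-seed

  representatives-leastPeriod : ∀ {S} → d ∣ suc b → S ∈ representatives d → LeastPeriod (w b S) d
  representatives-leastPeriod d∣b+1 S∈ with ∈-map⁻ seed S∈
  ... | r , r∈ , refl = w-seed-leastPeriod d∣b+1 r∈

  representatives-distinct : d ∣ suc b → AllPairs (λ S T → ¬ Similar (w b S) (w b T)) (representatives d)
  representatives-distinct {d = d} d∣b+1 = AllPairs.map⁺ (allPairs-map-∈ distinct (necklaces-distinct d))
    where
    distinct : ∀ {r r′} → r ∈ necklaces d → r′ ∈ necklaces d → ¬ cycle r ⇝ cycle r′ →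
               ¬ Similar (w b (seed r)) (w b (seed r′))
    distinct r∈ r′∈ r↛r′ S≈T = r↛r′ (⇝-trans (cycle⇝w-seed d∣b+1 r∈)
      (⇝-trans (similar⇒⇝ (proj₁ (w-seed-leastPeriod d∣b+1 r′∈)) S≈T) (w-seed⇝cycle d∣b+1 r′∈)))

  w-periodic : ∀ {S} → IsPeriod (w b S) ℓ → Periodic (w b S) (2 + c)
  w-periodic {S = S} (1≤ℓ , Pℓ) = periodic-eventually 1≤ℓ Pℓ (w-eventually-periodic S)

  representative-complete : ∀ {S} → ℓ ∣ suc b → LeastPeriod (w b S) ℓ →
                            ∃ λ T → T ∈ representatives ℓ × w b S ⇝ w b T
  representative-complete {S = S} ℓ∣b+1 L =
    let r , r∈ , r⇝S = necklace-complete (w-good S (w-periodic (proj₁ L))) L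
    in seed r , ∈-map⁺ seed r∈ , ⇝-trans (⇝-sym (proj₁ (necklace-leastPeriod r∈)) r⇝S) (cycle⇝w-seed ℓ∣b+1 r∈)

  similar-to : ∀ {S} → (∃ λ T → T ∈ xs × w b S ⇝ w b T) → Any (λ T → Similar (w b S) (w b T)) xs
  similar-to (T , T∈ , S⇝T) = lose T∈ (⇝⇒similar S⇝T)

  numPeriodicitiesOfLength : ℓ ∣ suc b → NumPeriodicitiesOfLength b ℓ (length (necklaces ℓ))
  numPeriodicitiesOfLength {ℓ = ℓ} ℓ∣b+1 =
    representatives ℓ , length-map seed (necklaces ℓ) , All.tabulate (representatives-leastPeriod ℓ∣b+1) ,
    representatives-distinct ℓ∣b+1 , λ S L → similar-to (representative-complete ℓ∣b+1 L)

  tailSeed : Vec Bool b → Vec Bool b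
  tailSeed S = prefix b (shift (suc b) (ext b S))

  tailSeed-periodic : ∀ S → IsPeriod (w b (tailSeed S)) (suc b)
  tailSeed-periodic S =
    s≤s z≤n , periodic-≗ (λ n → sym (w-shift S (suc b) n)) (periodic-from (suc b) (w-eventually-periodic S))

  ⇝-tailSeed : ∀ S → w b S ⇝ w b (tailSeed S)
  ⇝-tailSeed S = ⇝-≗ (λ n → sym (w-shift S (suc b) n)) (⇝-shift (suc b))

  allRepresentatives : List (Vec Bool b)
  allRepresentatives = concatDivUpTo representatives (suc b) (suc b)

  allRepresentatives-complete : ∀ S → ∃ λ T → T ∈ allRepresentatives × w b S ⇝ w b T
  allRepresentatives-complete S = via-least-period (leastPeriod-exists (tailSeed-periodic S))
    where
    via-least-period : (∃ λ d → LeastPeriod (w b (tailSeed S)) d) → ∃ λ T → T ∈ allRepresentatives × w b S ⇝ w b T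
    via-least-period (d , L) =
      let d∣b+1         = leastPeriod-∣ L (tailSeed-periodic S)
          T , T∈ , S′⇝T = representative-complete d∣b+1 L
      in T , ∈-concatDivUpTo⁺ representatives (suc b) (proj₁ (proj₁ L)) (∣⇒≤ d∣b+1) d∣b+1 T∈ ,
         ⇝-trans (⇝-tailSeed S) S′⇝T

  numPeriodicities : NumPeriodicities b (length allRepresentatives)
  numPeriodicities =
    allRepresentatives , refl , All.universal (λ _ → tt) _ ,
    allPairs-concatDivUpTo representatives (suc b) (λ _ → representatives-distinct) across (suc b) ,
    λ S _ → similar-to (allRepresentatives-complete S)
    where
    across : ∀ {d d′ S T} → d < d′ → 1 ≤ d → d ∣ suc b → d′ ∣ suc b →
             S ∈ representatives d → T ∈ representatives d′ → ¬ Similar (w b S) (w b T)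
    across d<d′ _ d∣b+1 d′∣b+1 S∈ T∈ S≈T =
      <⇒≢ d<d′ (leastPeriod-unique (⇝-leastPeriod (similar⇒⇝ (proj₁ LT) S≈T) LS) LT)
      where
      LS = representatives-leastPeriod d∣b+1 S∈
      LT = representatives-leastPeriod d′∣b+1 T∈

  length-allRepresentatives : toℚ (length allRepresentatives) ≡ N (suc b)
  length-allRepresentatives =
    trans (toℚ-length-concatDivUpTo representatives (suc b) (suc b))
          (sumDivUpTo-cong {f = toℚ ∘ length ∘ representatives} {g = N'} (suc b) (suc b) λ d 1≤d _ →
             trans (cong toℚ (length-map seed (necklaces d))) (sym (N'≡length-necklaces d 1≤d)))

proposition3p11 : (b : ℕ) → 2 ≤ b →
    ((ℓ : ℕ) → 1 ≤ ℓ → ℓ ∣ suc b →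
    Σ ℕ (λ k → NumPeriodicitiesOfLength b ℓ k × toℚ k ≡ N' ℓ))
    × Σ ℕ (λ k → NumPeriodicities b k × toℚ k ≡ N (suc b))
-- 2 ≤ b only rules out b = 0: the argument works for every b ≥ 1.
proposition3p11 (suc c) _ =
  (λ ℓ 1≤ℓ ℓ∣b+1 → length (necklaces ℓ) , numPeriodicitiesOfLength c ℓ∣b+1 , sym (N'≡length-necklaces ℓ 1≤ℓ)) ,
  (length (allRepresentatives c) , numPeriodicities c , length-allRepresentatives c)
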